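{- Let $n\ge 1$ and let $P(n)$ be the $\mathbb{Q}$-vector space with basis the set $\Pi(n)$ of all set partitions of $[n]=\{1,\dots,n\}$. For $1\le i\le n-1$ define the linear operator $\rho_i:P(n)\to P(n)$ on basis elements $\pi\in\Pi(n)$ by $\rho_i(\pi)=-s_i(\pi)$ if $\mathrm{val}_i(\pi)\ge 1$ and $\mathrm{val}_{i+1}(\pi)\ge 1$, and $\rho_i(\pi)=s_i(\pi)$ otherwise (i.e. if $\{i\}$ or $\{i+1\}$ is a block of $\pi$). Then the operators $\rho_1,\dots,\rho_{n-1}$ satisfy the Coxeter relations of $\mathfrak{S}_n$: $\rho_i^2=1$ for all $i$, $\rho_i\rho_j=\rho_j\rho_i$ whenever $|i-j|>1$, and $\rho_i\rho_{i+1}\rho_i=\rho_{i+1}\rho_i\rho_{i+1}$ for $1\le i\le n-2$.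
   Context: $\mathfrak{S}_n$ is the symmetric group on $[n]$ and $s_i=(i,i+1)$. For $w\in\mathfrak{S}_n$ and a set partition $\pi$ of $[n]$, $w(\pi)$ is the set partition in which $w(a)$ and $w(b)$ lie in the same block iff $a$ and $b$ lie in the same block of $\pi$. For $i\in[n]$, $B_i(\pi)$ is the block of $\pi$ containing $i$, and the valence $\mathrm{val}_i(\pi)$ is $0$ if $|B_i(\pi)|=1$, $1$ if $|B_i(\pi)|=2$, and $2$ if $|B_i(\pi)|>2$. -}

module Defs where

open import Data.Bool using (Bool; true; false; if_then_else_)
open import Data.Bool.Properties renaming (_≟_ to _≟ᵇ_)
open import Data.Nat using (ℕ; zero; suc)
open import Data.Nat.ListAction using (sum)
open import Data.Fin using (Fin; inject₁) renaming (suc to fsuc)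
open import Data.List using (List; []; _∷_; _++_; map; allFin)
open import Data.Bool.ListAction using (and)
open import Data.Product using (_×_; _,_)
open import Data.Fin.Permutation using (Permutation′; _⟨$⟩ˡ_; transpose)
open import Data.Rational using (ℚ; 0ℚ; 1ℚ; _+_; _*_; -_)
open import Relation.Nullary using (does)
open import Relation.Binary.PropositionalEquality using (_≡_)

-- A set partition of [n] (here [n] = Fin n, element k of Fin n standing
-- for k+1), given by its decidable equivalence relation
-- "a and b lie in the same block".
record SetPartition (n : ℕ) : Set where
  field
    rel    : Fin n → Fin n → Bool
    isRefl  : ∀ a → rel a a ≡ true
    isSym   : ∀ a b → rel a b ≡ true → rel b a ≡ true
    isTrans : ∀ a b c → rel a b ≡ true → rel b c ≡ true → rel a c ≡ true
open SetPartition public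

samePartition : ∀ {n} → SetPartition n → SetPartition n → Bool
samePartition {n} π σ =
  and (map (λ a → and (map (λ b → does (rel π a b ≟ᵇ rel σ a b)) (allFin n))) (allFin n))

-- w(π): w(a), w(b) in the same block iff a, b in the same block of π.
act : ∀ {n} → Permutation′ n → SetPartition n → SetPartition n
act w π = record
  { rel     = λ x y → rel π (w ⟨$⟩ˡ x) (w ⟨$⟩ˡ y)
  ; isRefl  = λ a → isRefl π (w ⟨$⟩ˡ a)
  ; isSym   = λ a b → isSym π (w ⟨$⟩ˡ a) (w ⟨$⟩ˡ b)
  ; isTrans = λ a b c → isTrans π (w ⟨$⟩ˡ a) (w ⟨$⟩ˡ b) (w ⟨$⟩ˡ c)
  }

blockSize : ∀ {n} → SetPartition n → Fin n → ℕ
blockSize {n} π i = sum (map (λ b → if rel π i b then 1 else 0) (allFin n))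

val : ∀ {n} → SetPartition n → Fin n → ℕ
val π i with blockSize π i
... | 0 = 0
... | 1 = 0
... | 2 = 1
... | suc (suc (suc _)) = 2

-- P(n): the ℚ-vector space with basis Π(n), as formal ℚ-linear
-- combinations of set partitions, compared by coefficients.
P : ℕ → Set
P n = List (ℚ × SetPartition n)

coeff : ∀ {n} → P n → SetPartition n → ℚ
coeff [] π = 0ℚ
coeff ((q , σ) ∷ v) π =
  (if samePartition σ π then q else 0ℚ) + coeff v π

infix 4 _≈_
_≈_ : ∀ {n} → P n → P n → Set
v ≈ w = ∀ π → coeff v π ≡ coeff w π

-- s_i for 0-based i : Fin m acting on Fin (suc m): swaps i and i+1.
-- (Paper index = toℕ i + 1.)
s : ∀ {m} → Fin m → Permutation′ (suc m)
s i = transpose (inject₁ i) (fsuc i)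

ρbasis : ∀ {m} → Fin m → SetPartition (suc m) → P (suc m)
ρbasis i π with val π (inject₁ i) | val π (fsuc i)
... | suc _ | suc _ = (- 1ℚ , act (s i) π) ∷ []
... | _     | _     = (1ℚ , act (s i) π) ∷ []

scale : ∀ {k} → ℚ → P k → P k
scale c = map (λ { (r , σ) → (c * r , σ) })

ρ : ∀ {m} → Fin m → P (suc m) → P (suc m)
ρ i [] = []
ρ i ((q , π) ∷ v) = scale q (ρbasis i π) ++ ρ i v

-- Taking coefficients turns ρ_i into the operator c ↦ (π ↦ ε_π(i,i+1) · c(s_i π)) on functions
-- of partitions, where ε_π(x,y) is −1 exactly when neither x nor y is a singleton block of π.
-- Relabelling preserves block sizes, so ε_{w π}(x,y) = ε_π(w⁻¹x, w⁻¹y), and the operator makes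
-- sense for every transposition (x y).  The Coxeter relations then split into the relations of
-- the transpositions themselves, which follow from the conjugation rule g (x y) g⁻¹ = (gx gy),
-- and a count of signs: for disjoint pairs the signs are untouched, ε² = 1 gives the
-- involution, and in a braid word each side picks up ε(x,y), ε(x,z), ε(y,z) exactly once.

module Submission where

open import Defs
open import Algebra.Bundles using (CommutativeMonoid)
open import Data.Bool using (Bool; T; true; false; if_then_else_)
open import Data.Bool.Properties using (T-≡; ⇔→≡) renaming (_≟_ to _≟ᵇ_)
open import Data.Fin using (Fin; toℕ; inject₁) renaming (zero to fzero; suc to fsuc)
open import Data.Fin.Permutation as Perm using (Permutation′; _⟨$⟩ˡ_; flip)
open import Data.Fin.Permutation.Components using (transpose; transpose-inverse)
open import Data.Fin.Properties using (_≟_; toℕ-inject₁; toℕ-injective)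
open import Data.List using (map; allFin; tabulate; []; _∷_)
open import Data.List.Membership.Propositional.Properties using (∈-allFin)
open import Data.List.Properties using (map-cong; map-tabulate)
import Data.List.Relation.Unary.All as All
open import Data.List.Relation.Unary.All.Properties using (all⁺; all⁻; tabulate⁺)
import Data.Nat as ℕ
open import Data.Nat using (ℕ; zero; suc; _<_; ∣_-_∣; s≤s)
open import Data.Nat.ListAction using (sum)
open import Data.Nat.Properties
  using ( +-0-commutativeMonoid; ∣n-n∣≡0; ∣-∣-comm; n≮0; <-irrefl; <-trans; <⇒≢; ≤-reflexive
        ; suc-injective)
open import Algebra.Properties.CommutativeMonoid.Sum +-0-commutativeMonoid
  using (sum-permute) renaming (sum to ∑)
open import Data.Product using (_×_; _,_)
open import Data.Rational using (ℚ; 0ℚ; 1ℚ; _+_; _*_; -_)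
open import Data.Rational.Properties
  using (*-comm; *-assoc; *-zeroʳ; *-identityˡ; *-distribˡ-+; *-1-commutativeMonoid)
open import Algebra.Properties.CommutativeSemigroup
  (CommutativeMonoid.commutativeSemigroup *-1-commutativeMonoid) using (x∙yz≈y∙xz)
open import Function using (_⇔_; mk⇔; Equivalence; _∘_)
open import Function.Definitions using (Congruent; Injective)
open import Function.Construct.Composition using (_⇔-∘_)
open import Function.Construct.Symmetry using (⇔-sym)
open import Relation.Binary.PropositionalEquality
open import Relation.Nullary using (yes; no; does)
open import Relation.Nullary.Decidable using (dec-true; dec-false; toWitness; fromWitness; isYes≗does)

open Equivalence using (to; from)

private variable
  n m : ℕ

-- A record rather than a Π-type, so that π and σ are inferable from a proof.
infix 4 _≐_
record _≐_ (π σ : SetPartition n) : Set where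
  constructor mk≐
  field rel-≡ : ∀ a b → rel π a b ≡ rel σ a b
open _≐_

≐-sym : {π σ : SetPartition n} → π ≐ σ → σ ≐ π
≐-sym π≐σ = mk≐ λ a b → sym (rel-≡ π≐σ a b)

≐-trans : {π σ τ : SetPartition n} → π ≐ σ → σ ≐ τ → π ≐ τ
≐-trans π≐σ σ≐τ = mk≐ λ a b → trans (rel-≡ π≐σ a b) (rel-≡ σ≐τ a b)

T-does-≟ᵇ : (p q : Bool) → T (does (p ≟ᵇ q)) ⇔ p ≡ q
T-does-≟ᵇ p q = mk⇔ (toWitness {a? = p ≟ᵇ q} ∘ subst T (sym (isYes≗does (p ≟ᵇ q))))
                    (subst T (isYes≗does (p ≟ᵇ q)) ∘ fromWitness)

T-samePartition : {π σ : SetPartition n} → T (samePartition π σ) ⇔ π ≐ σ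
T-samePartition {n} {π} {σ} = mk⇔
  (λ h → mk≐ λ a b → to (T-does-≟ᵇ _ _) (at b (all⁺ _ (allFin n) (at a (all⁺ _ (allFin n) h)))))
  (λ π≐σ → all⁻ _ (tabulate⁺ λ a → all⁻ _ (tabulate⁺ λ b → from (T-does-≟ᵇ _ _) (rel-≡ π≐σ a b))))
  where
  at : ∀ {P : Fin n → Set} x → All.All P (allFin n) → P x
  at x all = All.lookup all (∈-allFin x)

samePartition-⇔ : {π σ π′ σ′ : SetPartition n} →
                  (π ≐ σ ⇔ π′ ≐ σ′) → samePartition π σ ≡ samePartition π′ σ′
samePartition-⇔ iff = ⇔→≡ {z = true}
  (T-≡ ⇔-∘ (⇔-sym T-samePartition ⇔-∘ (iff ⇔-∘ (T-samePartition ⇔-∘ ⇔-sym T-≡))))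

coeff-cong : (v : P n) → Congruent _≐_ _≡_ (coeff v)
coeff-cong []            π≐σ = refl
coeff-cong ((q , ξ) ∷ v) {π} {σ} π≐σ =
  cong₂ _+_ (cong (λ b → if b then q else 0ℚ) (samePartition-⇔ same-as-π⇔same-as-σ))
            (coeff-cong v π≐σ)
  where
  same-as-π⇔same-as-σ : ξ ≐ π ⇔ ξ ≐ σ
  same-as-π⇔same-as-σ = mk⇔ (λ ξ≐π → ≐-trans ξ≐π π≐σ) (λ ξ≐σ → ≐-trans ξ≐σ (≐-sym π≐σ))

sum-map-allFin : (f : Fin n → ℕ) → sum (map f (allFin n)) ≡ ∑ f
sum-map-allFin {n} f = trans (cong sum (map-tabulate {n = n} (λ x → x) f)) (sum-tabulate n f)
  where
  sum-tabulate : ∀ n (f : Fin n → ℕ) → sum (tabulate f) ≡ ∑ f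
  sum-tabulate zero    f = refl
  sum-tabulate (suc n) f = cong (f fzero ℕ.+_) (sum-tabulate n (f ∘ fsuc))

sum-map-allFin-permute : (f : Fin n → ℕ) (w : Permutation′ n) →
                         sum (map (λ b → f (w ⟨$⟩ˡ b)) (allFin n)) ≡ sum (map f (allFin n))
sum-map-allFin-permute f w = begin
  sum (map (λ b → f (w ⟨$⟩ˡ b)) (allFin _)) ≡⟨ sum-map-allFin (λ b → f (w ⟨$⟩ˡ b)) ⟩
  ∑ (λ b → f (w ⟨$⟩ˡ b))                    ≡⟨ sum-permute f (flip w) ⟨
  ∑ f                                        ≡⟨ sum-map-allFin f ⟨
  sum (map f (allFin _))                     ∎
  where open ≡-Reasoning

blockSize-act : (w : Permutation′ n) (π : SetPartition n) (x : Fin n) →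
                blockSize (act w π) x ≡ blockSize π (w ⟨$⟩ˡ x)
blockSize-act w π x = sum-map-allFin-permute (λ b → if rel π (w ⟨$⟩ˡ x) b then 1 else 0) w

blockSize-cong : {π σ : SetPartition n} → π ≐ σ → ∀ x → blockSize π x ≡ blockSize σ x
blockSize-cong {n} π≐σ x =
  cong sum (map-cong (λ b → cong (λ r → if r then 1 else 0) (rel-≡ π≐σ x b)) (allFin n))

val-from-blockSize : (π σ : SetPartition n) {x y : Fin n} →
                     blockSize π x ≡ blockSize σ y → val π x ≡ val σ y
val-from-blockSize π σ {x} {y} e with blockSize π x | blockSize σ y | e
... | k | .k | refl = refl

val-act : (w : Permutation′ n) (π : SetPartition n) (x : Fin n) →
          val (act w π) x ≡ val π (w ⟨$⟩ˡ x)
val-act w π x = val-from-blockSize (act w π) π (blockSize-act w π x)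

val-cong : {π σ : SetPartition n} → π ≐ σ → ∀ x → val π x ≡ val σ x
val-cong {π = π} {σ} π≐σ x = val-from-blockSize π σ (blockSize-cong π≐σ x)

sgn : ℕ → ℕ → ℚ
sgn (suc _) (suc _) = - 1ℚ
sgn _       _       = 1ℚ

sgn-comm : ∀ k l → sgn k l ≡ sgn l k
sgn-comm zero    zero    = refl
sgn-comm zero    (suc _) = refl
sgn-comm (suc _) zero    = refl
sgn-comm (suc _) (suc _) = refl

sgn-square : ∀ k l → sgn k l * sgn k l ≡ 1ℚ
sgn-square zero    _       = refl
sgn-square (suc _) zero    = refl
sgn-square (suc _) (suc _) = refl

ε : SetPartition n → Fin n → Fin n → ℚ
ε π x y = sgn (val π x) (val π y)

ε-comm : (π : SetPartition n) (x y : Fin n) → ε π x y ≡ ε π y x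
ε-comm π x y = sgn-comm (val π x) (val π y)

ε-square : (π : SetPartition n) (x y : Fin n) → ε π x y * ε π x y ≡ 1ℚ
ε-square π x y = sgn-square (val π x) (val π y)

ε-cong : {π σ : SetPartition n} → π ≐ σ → ∀ x y → ε π x y ≡ ε σ x y
ε-cong π≐σ x y = cong₂ sgn (val-cong π≐σ x) (val-cong π≐σ y)

ε-act : (w : Permutation′ n) (π : SetPartition n) (x y : Fin n) {x′ y′ : Fin n} →
        w ⟨$⟩ˡ x ≡ x′ → w ⟨$⟩ˡ y ≡ y′ → ε (act w π) x y ≡ ε π x′ y′
ε-act w π x y refl refl = cong₂ sgn (val-act w π x) (val-act w π y)

ρbasis-singleton : (i : Fin m) (π : SetPartition (suc m)) →
                   ρbasis i π ≡ (ε π (inject₁ i) (fsuc i) , act (s i) π) ∷ []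
ρbasis-singleton i π with val π (inject₁ i) | val π (fsuc i)
... | zero  | _     = refl
... | suc _ | zero  = refl
... | suc _ | suc _ = refl

transpose-matchˡ : ∀ (i j : Fin n) → transpose i j i ≡ j
transpose-matchˡ i j rewrite dec-true (i ≟ i) refl = refl

transpose-matchʳ : ∀ (i j : Fin n) → transpose i j j ≡ i
transpose-matchʳ i j with j ≟ i
... | yes j≡i = j≡i
... | no  j≢i rewrite dec-true (j ≟ j) refl = refl

transpose-mismatch : {i j k : Fin n} → i ≢ k → j ≢ k → transpose i j k ≡ k
transpose-mismatch {i = i} {j} {k} i≢k j≢k
  rewrite dec-false (k ≟ i) (≢-sym i≢k) | dec-false (k ≟ j) (≢-sym j≢k) = refl

transpose-comm : ∀ (i j k : Fin n) → transpose i j k ≡ transpose j i k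
transpose-comm i j k with i ≟ k | j ≟ k
... | yes refl | _        = trans (transpose-matchˡ k j) (sym (transpose-matchʳ j k))
... | no  _    | yes refl = trans (transpose-matchʳ i k) (sym (transpose-matchˡ k i))
... | no  i≢k  | no  j≢k  =
  trans (transpose-mismatch i≢k j≢k) (sym (transpose-mismatch j≢k i≢k))

transpose-involutive : ∀ (i j k : Fin n) → transpose i j (transpose i j k) ≡ k
transpose-involutive i j k = trans (cong (transpose i j) (transpose-comm i j k)) (transpose-inverse i j)

transpose-injective : ∀ (i j : Fin n) → Injective _≡_ _≡_ (transpose i j)
transpose-injective i j {k} {l} e =
  trans (sym (transpose-involutive i j k)) (trans (cong (transpose i j) e) (transpose-involutive i j l))

transpose-conjugate : {g : Fin n → Fin n} → Injective _≡_ _≡_ g →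
                      ∀ i j k → g (transpose i j k) ≡ transpose (g i) (g j) (g k)
transpose-conjugate {g = g} g-inj i j k with i ≟ k | j ≟ k
... | yes refl | _        = trans (cong g (transpose-matchˡ k j)) (sym (transpose-matchˡ (g k) (g j)))
... | no  _    | yes refl = trans (cong g (transpose-matchʳ i k)) (sym (transpose-matchʳ (g i) (g k)))
... | no  i≢k  | no  j≢k  =
  trans (cong g (transpose-mismatch i≢k j≢k))
        (sym (transpose-mismatch (i≢k ∘ g-inj) (j≢k ∘ g-inj)))

transpose-commute : ∀ {i j k l : Fin n} → i ≢ k → i ≢ l → j ≢ k → j ≢ l →
                    ∀ x → transpose i j (transpose k l x) ≡ transpose k l (transpose i j x)
transpose-commute {i = i} {j} {k} {l} i≢k i≢l j≢k j≢l x =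
  trans (transpose-conjugate (transpose-injective i j) k l x)
        (cong₂ (λ a b → transpose a b (transpose i j x))
               (transpose-mismatch i≢k j≢k) (transpose-mismatch i≢l j≢l))

-- Conjugating the middle transposition by the outer one shows that both sides are transpose k i.
transpose-braid : ∀ {i j k : Fin n} → i ≢ j → i ≢ k → j ≢ k →
                  ∀ x → transpose j i (transpose k j (transpose j i x))
                      ≡ transpose k j (transpose j i (transpose k j x))
transpose-braid {i = i} {j} {k} i≢j i≢k j≢k x = begin
  transpose j i (transpose k j (transpose j i x))
    ≡⟨ transpose-conjugate (transpose-injective j i) k j (transpose j i x) ⟩
  transpose (transpose j i k) (transpose j i j) (transpose j i (transpose j i x))
    ≡⟨ transpose-cong (transpose-mismatch j≢k i≢k) (transpose-matchˡ j i)
                      (transpose-involutive j i x) ⟩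
  transpose k i x
    ≡⟨ transpose-cong (transpose-matchʳ k j) (transpose-mismatch (≢-sym i≢k) (≢-sym i≢j))
                      (transpose-involutive k j x) ⟨
  transpose (transpose k j j) (transpose k j i) (transpose k j (transpose k j x))
    ≡⟨ transpose-conjugate (transpose-injective k j) j i (transpose k j x) ⟨
  transpose k j (transpose j i (transpose k j x)) ∎
  where
  open ≡-Reasoning
  transpose-cong : ∀ {a a′ b b′ c c′ : Fin n} → a ≡ a′ → b ≡ b′ → c ≡ c′ →
                   transpose a b c ≡ transpose a′ b′ c′
  transpose-cong refl refl refl = refl

relabel : (Fin n → Fin n) → SetPartition n → SetPartition n
relabel f π = record
  { rel     = λ a b → rel π (f a) (f b)
  ; isRefl  = λ a → isRefl π (f a)
  ; isSym   = λ a b → isSym π (f a) (f b)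
  ; isTrans = λ a b c → isTrans π (f a) (f b) (f c)
  }

-- act w π is definitionally relabel (w ⟨$⟩ˡ_) π, and iterated swaps are relabellings by the
-- composite, so relabel-cong compares them.
relabel-cong : (π : SetPartition n) {f g : Fin n → Fin n} → f ≗ g → relabel f π ≐ relabel g π
relabel-cong π f≗g = mk≐ λ a b → cong₂ (rel π) (f≗g a) (f≗g b)

swap : Fin n → Fin n → SetPartition n → SetPartition n
swap i j = act (Perm.transpose i j)

swap-involutive : (i j : Fin n) (π : SetPartition n) → swap i j (swap i j π) ≐ π
swap-involutive i j π = relabel-cong π (transpose-involutive j i)

swap-cong : (i j : Fin n) {σ τ : SetPartition n} → σ ≐ τ → swap i j σ ≐ swap i j τ
swap-cong i j σ≐τ = mk≐ λ a b → rel-≡ σ≐τ (transpose j i a) (transpose j i b)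

swap-adjoint : (i j : Fin n) {σ τ : SetPartition n} → swap i j σ ≐ τ ⇔ σ ≐ swap i j τ
swap-adjoint i j {σ} {τ} = mk⇔
  (λ h → ≐-trans (≐-sym (swap-involutive i j σ)) (swap-cong i j h))
  (λ h → ≐-trans (swap-cong i j h) (swap-involutive i j τ))

ε-swap : (i j : Fin n) (π : SetPartition n) (x y : Fin n) {x′ y′ : Fin n} →
         transpose j i x ≡ x′ → transpose j i y ≡ y′ → ε (swap i j π) x y ≡ ε π x′ y′
ε-swap i j = ε-act (Perm.transpose i j)

ε-swap-self : (i j : Fin n) (π : SetPartition n) → ε (swap i j π) i j ≡ ε π i j
ε-swap-self i j π =
  trans (ε-swap i j π i j (transpose-matchʳ j i) (transpose-matchˡ j i)) (ε-comm π j i)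

signedSwap : Fin n → Fin n → (SetPartition n → ℚ) → SetPartition n → ℚ
signedSwap i j c π = ε π i j * c (swap i j π)

signedSwap-cong : (i j : Fin n) {c d : SetPartition n → ℚ} → c ≗ d →
                  signedSwap i j c ≗ signedSwap i j d
signedSwap-cong i j c≗d π = cong (ε π i j *_) (c≗d (swap i j π))

signedSwap-involutive : (i j : Fin n) {c : SetPartition n → ℚ} → Congruent _≐_ _≡_ c →
                        signedSwap i j (signedSwap i j c) ≗ c
signedSwap-involutive i j {c} c-cong π = begin
  ε π i j * (ε (swap i j π) i j * c π″) ≡⟨ cong (λ e → ε π i j * (e * c π″)) (ε-swap-self i j π) ⟩
  ε π i j * (ε π i j * c π″)             ≡⟨ *-assoc (ε π i j) (ε π i j) (c π″) ⟨
  ε π i j * ε π i j * c π″               ≡⟨ cong₂ _*_ (ε-square π i j) (c-cong (swap-involutive i j π)) ⟩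
  1ℚ * c π                               ≡⟨ *-identityˡ (c π) ⟩
  c π                                    ∎
  where
  open ≡-Reasoning
  π″ = swap i j (swap i j π)

signedSwap-commute : ∀ {i j k l : Fin n} → i ≢ k → i ≢ l → j ≢ k → j ≢ l →
                     {c : SetPartition n → ℚ} → Congruent _≐_ _≡_ c →
                     signedSwap i j (signedSwap k l c) ≗ signedSwap k l (signedSwap i j c)
signedSwap-commute {i = i} {j} {k} {l} i≢k i≢l j≢k j≢l {c} c-cong π = begin
  ε π i j * (ε (swap i j π) k l * c (swap k l (swap i j π)))
    ≡⟨ cong (λ e → ε π i j * (e * c (swap k l (swap i j π))))
            (ε-swap i j π k l (transpose-mismatch j≢k i≢k) (transpose-mismatch j≢l i≢l)) ⟩
  ε π i j * (ε π k l * c (swap k l (swap i j π)))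
    ≡⟨ x∙yz≈y∙xz (ε π i j) (ε π k l) _ ⟩
  ε π k l * (ε π i j * c (swap k l (swap i j π)))
    ≡⟨ cong (λ z → ε π k l * (ε π i j * z)) (c-cong swaps-commute) ⟩
  ε π k l * (ε π i j * c (swap i j (swap k l π)))
    ≡⟨ cong (λ e → ε π k l * (e * c (swap i j (swap k l π))))
            (ε-swap k l π i j (transpose-mismatch (≢-sym i≢l) (≢-sym i≢k))
                              (transpose-mismatch (≢-sym j≢l) (≢-sym j≢k))) ⟨
  ε π k l * (ε (swap k l π) i j * c (swap i j (swap k l π))) ∎
  where
  open ≡-Reasoning
  swaps-commute : swap k l (swap i j π) ≐ swap i j (swap k l π)
  swaps-commute = relabel-cong π (transpose-commute j≢l j≢k i≢l i≢k)

signedSwap-braid : ∀ {i j k : Fin n} → i ≢ j → i ≢ k → j ≢ k →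
                   {c : SetPartition n → ℚ} → Congruent _≐_ _≡_ c →
                   signedSwap i j (signedSwap j k (signedSwap i j c))
                     ≗ signedSwap j k (signedSwap i j (signedSwap j k c))
signedSwap-braid {i = i} {j} {k} i≢j i≢k j≢k {c} c-cong π = begin
  ε π i j * (ε (swap i j π) j k * (ε (swap j k (swap i j π)) i j * c X))
    ≡⟨ cong₂ (λ e f → ε π i j * (e * (f * c X))) ε-ij-jk ε-ij-jk-ij ⟩
  ε π i j * (ε π i k * (ε π j k * c X))
    ≡⟨ x∙yz≈y∙xz (ε π i j) (ε π i k) _ ⟩
  ε π i k * (ε π i j * (ε π j k * c X))
    ≡⟨ cong (ε π i k *_) (x∙yz≈y∙xz (ε π i j) (ε π j k) (c X)) ⟩
  ε π i k * (ε π j k * (ε π i j * c X))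
    ≡⟨ x∙yz≈y∙xz (ε π i k) (ε π j k) _ ⟩
  ε π j k * (ε π i k * (ε π i j * c X))
    ≡⟨ cong (λ z → ε π j k * (ε π i k * (ε π i j * z))) (c-cong X≐Y) ⟩
  ε π j k * (ε π i k * (ε π i j * c Y))
    ≡⟨ cong₂ (λ e f → ε π j k * (e * (f * c Y))) ε-jk-ij ε-jk-ij-jk ⟨
  ε π j k * (ε (swap j k π) i j * (ε (swap i j (swap j k π)) j k * c Y)) ∎
  where
  open ≡-Reasoning
  X = swap i j (swap j k (swap i j π))
  Y = swap j k (swap i j (swap j k π))
  X≐Y : X ≐ Y
  X≐Y = relabel-cong π (transpose-braid i≢j i≢k j≢k)
  fixes-k : transpose j i k ≡ k
  fixes-k = transpose-mismatch j≢k i≢k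
  fixes-i : transpose k j i ≡ i
  fixes-i = transpose-mismatch (≢-sym i≢k) (≢-sym i≢j)
  ε-ij-jk : ε (swap i j π) j k ≡ ε π i k
  ε-ij-jk = ε-swap i j π j k (transpose-matchˡ j i) fixes-k
  ε-ij-jk-ij : ε (swap j k (swap i j π)) i j ≡ ε π j k
  ε-ij-jk-ij = trans (ε-swap j k (swap i j π) i j fixes-i (transpose-matchʳ k j))
                     (ε-swap i j π i k (transpose-matchʳ j i) fixes-k)
  ε-jk-ij : ε (swap j k π) i j ≡ ε π i k
  ε-jk-ij = ε-swap j k π i j fixes-i (transpose-matchʳ k j)
  ε-jk-ij-jk : ε (swap i j (swap j k π)) j k ≡ ε π i j
  ε-jk-ij-jk = trans (ε-swap i j (swap j k π) j k (transpose-matchˡ j i) fixes-k)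
                     (ε-swap j k π i k fixes-i (transpose-matchˡ k j))

ρᶜ : Fin m → (SetPartition (suc m) → ℚ) → SetPartition (suc m) → ℚ
ρᶜ i = signedSwap (inject₁ i) (fsuc i)

coeff-ρ : (i : Fin m) (v : P (suc m)) → coeff (ρ i v) ≗ ρᶜ i (coeff v)
coeff-ρ i []            π = sym (*-zeroʳ (ε π (inject₁ i) (fsuc i)))
coeff-ρ i ((q , σ) ∷ v) π rewrite ρbasis-singleton i σ =
  trans (cong₂ _+_ leading-term (coeff-ρ i v π)) (sym (*-distribˡ-+ (ε π a b) _ _))
  where
  a = inject₁ i
  b = fsuc i
  leading-term : (if samePartition (swap a b σ) π then q * ε σ a b else 0ℚ)
                 ≡ ε π a b * (if samePartition σ (swap a b π) then q else 0ℚ)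
  leading-term rewrite samePartition-⇔ (swap-adjoint a b {σ} {π})
    with samePartition σ (swap a b π) in same
  ... | true  = trans (*-comm q (ε σ a b))
                      (cong (_* q) (trans (ε-cong σ≐ a b) (ε-swap-self a b π)))
    where
    σ≐ : σ ≐ swap a b π
    σ≐ = to T-samePartition (from T-≡ same)
  ... | false = sym (*-zeroʳ (ε π a b))

∣n-1+n∣≡1 : ∀ k → ∣ k - suc k ∣ ≡ 1
∣n-1+n∣≡1 zero    = refl
∣n-1+n∣≡1 (suc k) = ∣n-1+n∣≡1 k

far-apart : ∀ k l → 1 < ∣ k - l ∣ → k ≢ l × k ≢ suc l × suc k ≢ l
far-apart k l 1<d =
    (λ { refl → n≮0 (subst (1 <_) (∣n-n∣≡0 k) 1<d) })
  , (λ { refl → <-irrefl refl (subst (1 <_) (trans (∣-∣-comm (suc l) l) (∣n-1+n∣≡1 l)) 1<d) })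
  , (λ { refl → <-irrefl refl (subst (1 <_) (∣n-1+n∣≡1 k) 1<d) })

adjacent-pairs-disjoint : (i j : Fin m) → 1 < ∣ toℕ i - toℕ j ∣ →
  inject₁ i ≢ inject₁ j × inject₁ i ≢ fsuc j × fsuc i ≢ inject₁ j × fsuc i ≢ fsuc j
adjacent-pairs-disjoint i j 1<d with far-apart (toℕ i) (toℕ j) 1<d
... | i≢j , i≢1+j , 1+i≢j =
    (λ e → i≢j (trans (sym (toℕ-inject₁ i)) (trans (cong toℕ e) (toℕ-inject₁ j))))
  , (λ e → i≢1+j (trans (sym (toℕ-inject₁ i)) (cong toℕ e)))
  , (λ e → 1+i≢j (trans (cong toℕ e) (toℕ-inject₁ j)))
  , (λ e → i≢j (suc-injective (cong toℕ e)))

adjacent-triple : (i j : Fin m) → toℕ j ≡ suc (toℕ i) →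
  inject₁ j ≡ fsuc i × inject₁ i ≢ fsuc i × inject₁ i ≢ fsuc j × fsuc i ≢ fsuc j
adjacent-triple i j j≡1+i =
    toℕ-injective (trans (toℕ-inject₁ j) j≡1+i)
  , (λ e → <⇒≢ a<b (cong toℕ e))
  , (λ e → <⇒≢ (<-trans a<b b<c) (cong toℕ e))
  , (λ e → <⇒≢ b<c (cong toℕ e))
  where
  a<b : toℕ (inject₁ i) < toℕ (fsuc i)
  a<b = s≤s (≤-reflexive (toℕ-inject₁ i))
  b<c : toℕ (fsuc i) < toℕ (fsuc j)
  b<c = s≤s (≤-reflexive (sym j≡1+i))

coeff-ρ² : (i j : Fin m) (v : P (suc m)) → coeff (ρ i (ρ j v)) ≗ ρᶜ i (ρᶜ j (coeff v))
coeff-ρ² i j v π = trans (coeff-ρ i (ρ j v) π) (signedSwap-cong _ _ (coeff-ρ j v) π)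

coeff-ρ³ : (i j k : Fin m) (v : P (suc m)) →
           coeff (ρ i (ρ j (ρ k v))) ≗ ρᶜ i (ρᶜ j (ρᶜ k (coeff v)))
coeff-ρ³ i j k v π = trans (coeff-ρ i (ρ j (ρ k v)) π) (signedSwap-cong _ _ (coeff-ρ² j k v) π)

ρ-involutive : (i : Fin m) (v : P (suc m)) → ρ i (ρ i v) ≈ v
ρ-involutive i v π = trans (coeff-ρ² i i v π) (signedSwap-involutive _ _ (coeff-cong v) π)

ρ-commute : (i j : Fin m) → 1 < ∣ toℕ i - toℕ j ∣ →
            (v : P (suc m)) → ρ i (ρ j v) ≈ ρ j (ρ i v)
ρ-commute i j 1<d v π with adjacent-pairs-disjoint i j 1<d
... | ai≢aj , ai≢bj , bi≢aj , bi≢bj = begin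
  coeff (ρ i (ρ j v)) π       ≡⟨ coeff-ρ² i j v π ⟩
  ρᶜ i (ρᶜ j (coeff v)) π     ≡⟨ signedSwap-commute ai≢aj ai≢bj bi≢aj bi≢bj (coeff-cong v) π ⟩
  ρᶜ j (ρᶜ i (coeff v)) π     ≡⟨ coeff-ρ² j i v π ⟨
  coeff (ρ j (ρ i v)) π       ∎
  where open ≡-Reasoning

ρ-braid : (i j : Fin m) → toℕ j ≡ suc (toℕ i) →
          (v : P (suc m)) → ρ i (ρ j (ρ i v)) ≈ ρ j (ρ i (ρ j v))
ρ-braid i j j≡1+i v π with adjacent-triple i j j≡1+i
... | aj≡bi , ai≢bi , ai≢bj , bi≢bj = begin
  coeff (ρ i (ρ j (ρ i v))) π          ≡⟨ coeff-ρ³ i j i v π ⟩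
  ρᶜ i (ρᶜ j (ρᶜ i (coeff v))) π       ≡⟨ ρᶜ-braid ⟩
  ρᶜ j (ρᶜ i (ρᶜ j (coeff v))) π       ≡⟨ coeff-ρ³ j i j v π ⟨
  coeff (ρ j (ρ i (ρ j v))) π          ∎
  where
  open ≡-Reasoning
  ρᶜ-braid : ρᶜ i (signedSwap (inject₁ j) (fsuc j) (ρᶜ i (coeff v))) π
           ≡ signedSwap (inject₁ j) (fsuc j) (ρᶜ i (signedSwap (inject₁ j) (fsuc j) (coeff v))) π
  ρᶜ-braid rewrite aj≡bi = signedSwap-braid ai≢bi ai≢bj bi≢bj (coeff-cong v) π

lemma2p1 : (m : ℕ)
  → ((i : Fin m) (v : P (suc m)) → ρ i (ρ i v) ≈ v)
  × ((i j : Fin m) → 1 < ∣ toℕ i - toℕ j ∣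
      → (v : P (suc m)) → ρ i (ρ j v) ≈ ρ j (ρ i v))
  × ((i j : Fin m) → toℕ j ≡ suc (toℕ i)
      → (v : P (suc m)) → ρ i (ρ j (ρ i v)) ≈ ρ j (ρ i (ρ j v)))
lemma2p1 m = ρ-involutive , ρ-commute , ρ-braid
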